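{- Let $n\ge 3$ and let $K_n$ be the complete graph on $n$ vertices. Then: (1) $\omega_f(K_n)=n$; (2) $K_n$ is not uniquely intersectable with respect to families (not u.i.f.).
   Context: All graphs are finite, simple and undirected. For a finite set $X$ and a finite (multi)family $\mathcal{F}$ of nonempty subsets of $X$, write $\mathbf{S}(\mathcal{F})=\bigcup_{S\in\mathcal{F}}S$. A multifamily representation of a graph $G$ is an assignment $v\mapsto S_v$ of a nonempty finite set to each vertex $v$ such that for all distinct vertices $u,v$, $|S_u\cap S_v|=1$ if $uv$ is an edge and $|S_u\cap S_v|=0$ otherwise (i.e. $G$ is the intersection multigraph of the family, whose edge multiplicities are the intersection sizes). It is a family representation if the sets $S_v$ are pairwise distinct. The family intersection number $\omega_f(G)$ is the minimum of $|\mathbf{S}(\mathcal{F})|$ over all family representations $\mathcal{F}$ of $G$. $G$ is uniquely intersectable with respect to families (u.i.f.) if, for a set $X$ with $|X|=\omega_f(G)$, any two family representations $\alpha,\beta$ of $G$ by subsets of $X$ are such that $\beta$ is obtained from $\alpha$ by a permutation of the elements of $X$. -}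

module Defs where

open import Data.Nat using (ℕ; _≥_)
open import Data.Fin using (Fin)
open import Data.Fin.Subset using (Subset; _∩_; ∣_∣; ⋃; Nonempty; _∈_)
open import Data.Fin.Permutation using (Permutation′; _⟨$⟩ʳ_)
open import Data.List.Base using (map; allFin)
open import Data.Product using (Σ; _×_)
open import Relation.Nullary using (¬_)
open import Relation.Binary.PropositionalEquality using (_≡_; _≢_)
open import Function.Definitions using (Injective)
open import Function.Bundles using (_⇔_)
open import Level using (0ℓ)

record Graph (n : ℕ) : Set₁ where
  field
    Adj    : Fin n → Fin n → Set
    sym    : ∀ {u v} → Adj u v → Adj v u
    irrefl : ∀ {u} → ¬ Adj u u

open Graph public

K : (n : ℕ) → Graph n
K n = record
  { Adj    = λ u v → u ≢ v
  ; sym    = λ u≢v v≡u → u≢v (Relation.Binary.PropositionalEquality.sym v≡u)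
  ; irrefl = λ u≢u → u≢u Relation.Binary.PropositionalEquality.refl
  }

record MultiRep {n : ℕ} (G : Graph n) (m : ℕ) (S : Fin n → Subset m) : Set where
  field
    nonempty : ∀ v → Nonempty (S v)
    edge     : ∀ u v → u ≢ v → Adj G u v → ∣ S u ∩ S v ∣ ≡ 1
    nonedge  : ∀ u v → u ≢ v → ¬ Adj G u v → ∣ S u ∩ S v ∣ ≡ 0

record FamRep {n : ℕ} (G : Graph n) (m : ℕ) (S : Fin n → Subset m) : Set where
  field
    multiRep : MultiRep G m S
    distinct : Injective _≡_ _≡_ S

UnionOf : ∀ {n m} → (Fin n → Subset m) → Subset m
UnionOf {n} S = ⋃ (map S (allFin n))

IsOmegaF : ∀ {n} → Graph n → ℕ → Set
IsOmegaF {n} G k =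
  Σ ℕ (λ m → Σ (Fin n → Subset m) (λ S → FamRep G m S × ∣ UnionOf S ∣ ≡ k))
  × (∀ m (S : Fin n → Subset m) → FamRep G m S → ∣ UnionOf S ∣ ≥ k)

UIF : ∀ {n} → Graph n → Set
UIF {n} G =
  ∀ k → IsOmegaF G k →
  ∀ (α β : Fin n → Subset k) → FamRep G k α → FamRep G k β →
  Σ (Permutation′ k) (λ π → ∀ v x → (x ∈ α v) ⇔ ((π ⟨$⟩ʳ x) ∈ β v))

module Submission where

-- The "star" sets {0, v}
-- (v ∈ Fin n, so vertex 0 gets {0}) represent K_n with union of size n.
-- Replacing {0} by its complement gives a second representation on the
-- same n points; no permutation relates the two, as it would have to map
-- a one-point set onto a set with n − 1 ≥ 2 points.
--
-- The lower bound ω_f(K_n) ≥ n is the de Bruijn–Erdős inequality for n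
-- distinct nonempty sets pairwise meeting in exactly one point, with union U.
-- If some point lies in all sets, the sets minus that point are disjoint and
-- at most one is empty, so |U| ≥ n.  Otherwise, assuming |U| < n, the
-- non-incidences (v , x), x ∈ U ∖ S_v, satisfy n |U ∖ S_v| < |U| (n − deg x);
-- weighting them by 1/(n |U ∖ S_v|) resp. 1/(|U| (n − deg x)) gives two
-- total weights equal to 1, the second strictly smaller: a contradiction.

open import Defs hiding (sym)
open import Data.Nat using (ℕ; _≥_; zero; suc; z≤n; s≤s)
import Data.Nat.Properties as ℕ
open import Data.Fin using (Fin; zero; suc; _≟_)
open import Data.Fin.Properties using (suc-injective; any?; all?; ¬∀⟶∃¬)
open import Data.Bool as Bool using (Bool; true; false; if_then_else_; _∧_; not)
open import Data.Bool.Properties using (¬-not)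
open import Data.Product using (_×_; ∃; ∃₂; _,_; proj₁; proj₂)
open import Data.Sum as Sum using (_⊎_; inj₁; inj₂; [_,_])
open import Function using (_∘_; flip)
open import Relation.Nullary using (¬_; does; yes; no; contradiction)
open import Relation.Nullary.Decidable using (dec-true; dec-false)
open import Relation.Binary.PropositionalEquality
  using (_≡_; _≢_; refl; sym; trans; cong; cong₂; subst; module ≡-Reasoning)

module Counting where
  open import Data.Nat using (_+_; _≤_; _<_)

  ∧-true⁻ : ∀ {a b} → a ∧ b ≡ true → a ≡ true × b ≡ true
  ∧-true⁻ {true} b≡true = refl , b≡true

  ∧-true⁺ : ∀ {a b} → a ≡ true → b ≡ true → a ∧ b ≡ true
  ∧-true⁺ refl refl = refl

  not-true⁻ : ∀ {a} → not a ≡ true → a ≡ false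
  not-true⁻ {false} _ = refl

  bool-ext : ∀ {a b} → (a ≡ true → b ≡ true) → (b ≡ true → a ≡ true) → a ≡ b
  bool-ext {true}  a⇒b _   = sym (a⇒b refl)
  bool-ext {false} _   b⇒a = sym (¬-not λ b≡true → contradiction (b⇒a b≡true) λ ())

  count : ∀ {k} → (Fin k → Bool) → ℕ
  count {zero}  f = 0
  count {suc k} f = (if f zero then 1 else 0) + count (f ∘ suc)

  _without_ : ∀ {k} → (Fin k → Bool) → Fin k → (Fin k → Bool)
  (f without i) j = f j ∧ not (does (j ≟ i))

  without⁺ : ∀ {k} {f : Fin k → Bool} {i j} → f j ≡ true → j ≢ i → (f without i) j ≡ true
  without⁺ {i = i} {j} fj j≢i rewrite fj | dec-false (j ≟ i) j≢i = refl

  without⁻ : ∀ {k} {f : Fin k → Bool} {i j} → (f without i) j ≡ true → f j ≡ true × j ≢ i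
  without⁻ {i = i} {j} p with ∧-true⁻ p
  ... | fj , ¬j≡i = fj , λ j≡i → contradiction (trans (sym ¬j≡i) (cong not (dec-true (j ≟ i) j≡i))) λ ()

  count-cong : ∀ {k} {f g : Fin k → Bool} → (∀ i → f i ≡ g i) → count f ≡ count g
  count-cong {zero}  f≗g = refl
  count-cong {suc k} f≗g = cong₂ _+_ (cong (λ b → if b then 1 else 0) (f≗g zero)) (count-cong (f≗g ∘ suc))

  count-true : ∀ k → count {k} (λ _ → true) ≡ k
  count-true zero    = refl
  count-true (suc k) = cong suc (count-true k)

  count-split : ∀ {k} (f g : Fin k → Bool) →
                count (λ i → f i ∧ g i) + count (λ i → f i ∧ not (g i)) ≡ count f
  count-split {zero}  f g = refl
  count-split {suc k} f g with f zero | g zero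
  ... | true  | true  = cong suc (count-split (f ∘ suc) (g ∘ suc))
  ... | true  | false = trans (ℕ.+-suc _ _) (cong suc (count-split (f ∘ suc) (g ∘ suc)))
  ... | false | _     = count-split (f ∘ suc) (g ∘ suc)

  count-without : ∀ {k} (f : Fin k → Bool) i → f i ≡ true → count f ≡ suc (count (f without i))
  count-without {suc k} f zero    fi rewrite fi = cong suc (count-cong λ j → sym (∧-true (f (suc j))))
    where
    ∧-true : ∀ b → b ∧ true ≡ b
    ∧-true true  = refl
    ∧-true false = refl
  count-without {suc k} f (suc i) fi with f zero
  ... | true  = cong suc (count-without (f ∘ suc) i fi)
  ... | false = count-without (f ∘ suc) i fi

  witness⇒count-pos : ∀ {k} (f : Fin k → Bool) i → f i ≡ true → 0 < count f
  witness⇒count-pos f i fi rewrite count-without f i fi = s≤s z≤n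

  count-pos⇒witness : ∀ {k} (f : Fin k → Bool) → 0 < count f → ∃ λ i → f i ≡ true
  count-pos⇒witness {suc k} f pos with f zero in f0
  ... | true  = zero , f0
  ... | false with count-pos⇒witness (f ∘ suc) pos
  ...   | i , fi = suc i , fi

  count-one⇒unique : ∀ {k} (f : Fin k → Bool) → count f ≡ 1 →
                     ∀ {i j} → f i ≡ true → f j ≡ true → i ≡ j
  count-one⇒unique f c {i} {j} fi fj with i ≟ j
  ... | yes i≡j = i≡j
  ... | no  i≢j = contradiction (subst (1 <_) c two) (ℕ.<-irrefl refl)
    where
    j-remains : (f without i) j ≡ true
    j-remains = without⁺ {f = f} fj (i≢j ∘ sym)
    two : 1 < count f
    two = subst (1 <_) (sym (count-without f i fi)) (s≤s (witness⇒count-pos (f without i) j j-remains))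

  count-injective : ∀ {a b} (f : Fin a → Bool) (g : Fin b → Bool) (h : Fin a → Fin b) →
                    (∀ i → f i ≡ true → g (h i) ≡ true) →
                    (∀ {i j} → f i ≡ true → f j ≡ true → h i ≡ h j → i ≡ j) →
                    count f ≤ count g
  count-injective {zero}  f g h maps inj = z≤n
  count-injective {suc a} f g h maps inj with f zero in f0
  ... | false = count-injective (f ∘ suc) g (h ∘ suc) (maps ∘ suc) (λ fi fj e → suc-injective (inj fi fj e))
  ... | true  = subst (suc (count (f ∘ suc)) ≤_) (sym (count-without g (h zero) (maps zero f0)))
                  (s≤s (count-injective (f ∘ suc) (g without h zero) (h ∘ suc) maps′
                         (λ fi fj e → suc-injective (inj fi fj e))))
    where
    maps′ : ∀ i → f (suc i) ≡ true → (g without h zero) (h (suc i)) ≡ true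
    maps′ i fi = without⁺ {f = g} (maps (suc i) fi) (λ e → contradiction (inj fi f0 e) λ ())

  find : ∀ {k} (f : Fin k → Bool) → (∃ λ i → f i ≡ true) ⊎ (∀ i → f i ≡ false)
  find f with any? (λ i → f i Bool.≟ true)
  ... | yes found = inj₁ found
  ... | no  none  = inj₂ λ i → ¬-not (λ fi → none (i , fi))

open Counting

module Fractions where
  open import Data.Nat as ℕ using ()
  open import Algebra.Bundles using (CommutativeRing)
  open import Data.Rational using (ℚ; 0ℚ; 1ℚ; _+_; _*_; _<_; _≤_; 1/_; positive; nonNegative)
  import Data.Rational.Properties as ℚ
  open import Algebra.Properties.Semiring.Mult (CommutativeRing.semiring ℚ.+-*-commutativeRing)
    using (×-assoc-*; ×1-homo-*) renaming (_×_ to _·_)   -- k · q = q + ⋯ + q (k times)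
  open import Algebra.Properties.CommutativeMonoid.Sum ℚ.+-0-commutativeMonoid
    using (sum; sum-cong-≗; sum-replicate; sum-replicate-zero; ∑-comm)

  ι : ℕ → ℚ
  ι k = k · 1ℚ

  ι-nonneg : ∀ k → 0ℚ ≤ ι k
  ι-nonneg zero    = ℚ.≤-refl
  ι-nonneg (suc k) = ℚ.+-mono-≤ (ℚ.<⇒≤ (ℚ.positive⁻¹ 1ℚ)) (ι-nonneg k)

  ι-pos : ∀ k → 0ℚ < ι (suc k)
  ι-pos k = ℚ.+-mono-<-≤ (ℚ.positive⁻¹ 1ℚ) (ι-nonneg k)

  ι-mono-< : ∀ {a b} → a ℕ.< b → ι a < ι b
  ι-mono-< {zero}  {suc b} _         = ι-pos b
  ι-mono-< {suc a} {suc b} (s≤s a<b) = ℚ.+-monoʳ-< 1ℚ (ι-mono-< a<b)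

  ·≡ι* : ∀ k q → k · q ≡ ι k * q
  ·≡ι* k q = sym (trans (×-assoc-* k 1ℚ q) (cong (k ·_) (ℚ.*-identityˡ q)))

  -- The reciprocal of a natural number (by convention 0 for 0).
  recip : ℕ → ℚ
  recip zero    = 0ℚ
  recip (suc k) = 1/ ι (suc k)
    where instance _ = ℚ.pos⇒nonZero (ι (suc k)) {{positive (ι-pos k)}}

  recip-pos : ∀ k → 0ℚ < recip (suc k)
  recip-pos k = ℚ.positive⁻¹ _ {{ℚ.1/pos⇒pos (ι (suc k)) {{positive (ι-pos k)}}}}

  ι*recip : ∀ k → ι (suc k) * recip (suc k) ≡ 1ℚ
  ι*recip k = ℚ.*-inverseʳ (ι (suc k)) {{ℚ.pos⇒nonZero (ι (suc k)) {{positive (ι-pos k)}}}}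

  recip-unique : ∀ k y → ι (suc k) * y ≡ 1ℚ → y ≡ recip (suc k)
  recip-unique k y ιy≡1 = begin
    y                          ≡⟨ ℚ.*-identityˡ y ⟨
    1ℚ * y                     ≡⟨ cong (_* y) (trans (ℚ.*-comm (recip (suc k)) (ι (suc k))) (ι*recip k)) ⟨
    recip (suc k) * ι (suc k) * y   ≡⟨ ℚ.*-assoc (recip (suc k)) _ y ⟩
    recip (suc k) * (ι (suc k) * y) ≡⟨ cong (recip (suc k) *_) ιy≡1 ⟩
    recip (suc k) * 1ℚ         ≡⟨ ℚ.*-identityʳ _ ⟩
    recip (suc k)              ∎
    where open ≡-Reasoning

  sum-indicator : ∀ {k} (f : Fin k → Bool) c → sum (λ i → if f i then c else 0ℚ) ≡ count f · c
  sum-indicator {zero}  f c = refl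
  sum-indicator {suc k} f c with f zero
  ... | true  = cong (c +_) (sum-indicator (f ∘ suc) c)
  ... | false = trans (ℚ.+-identityˡ _) (sum-indicator (f ∘ suc) c)

  sum-mono-≤ : ∀ {k} {f g : Fin k → ℚ} → (∀ i → f i ≤ g i) → sum f ≤ sum g
  sum-mono-≤ {zero}  f≤g = ℚ.≤-refl
  sum-mono-≤ {suc k} f≤g = ℚ.+-mono-≤ (f≤g zero) (sum-mono-≤ (f≤g ∘ suc))

  sum-mono-< : ∀ {k} {f g : Fin k → ℚ} → (∀ i → f i ≤ g i) → ∀ i → f i < g i → sum f < sum g
  sum-mono-< f≤g zero    fi<gi = ℚ.+-mono-<-≤ fi<gi (sum-mono-≤ (f≤g ∘ suc))
  sum-mono-< f≤g (suc i) fi<gi = ℚ.+-mono-≤-< (f≤g zero) (sum-mono-< (f≤g ∘ suc) i fi<gi)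

  recip-whole : ∀ {a} → 0 ℕ.< a → a · recip a ≡ 1ℚ
  recip-whole {suc a} _ = trans (·≡ι* (suc a) _) (ι*recip a)

  recip-share : ∀ {a b} → 0 ℕ.< a → 0 ℕ.< b → b · recip (a ℕ.* b) ≡ recip a
  recip-share {suc a} {suc b} _ _ = trans (·≡ι* (suc b) r) (recip-unique a _ (begin
    ι (suc a) * (ι (suc b) * r) ≡⟨ ℚ.*-assoc (ι (suc a)) _ r ⟨
    ι (suc a) * ι (suc b) * r   ≡⟨ cong (_* r) (×1-homo-* (suc a) (suc b)) ⟨
    ι (suc a ℕ.* suc b) * r     ≡⟨ ι*recip (b ℕ.+ a ℕ.* suc b) ⟩
    1ℚ                          ∎))
    where
    open ≡-Reasoning
    r = recip (suc a ℕ.* suc b)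

  -- a < b ⇒ 1/b < 1/a, since a · (1/b) < b · (1/b) = 1 = a · (1/a)
  recip-antitone : ∀ {a b} → 0 ℕ.< a → a ℕ.< b → recip b < recip a
  recip-antitone {suc a} {suc b} _ a<b = ℚ.*-cancelˡ-<-nonNeg (ι (suc a)) {{nonNegative (ι-nonneg (suc a))}}
    (subst (ι (suc a) * recip (suc b) <_) (trans (ι*recip b) (sym (ι*recip a)))
      (ℚ.*-monoˡ-<-pos (recip (suc b)) {{positive (recip-pos b)}} (ι-mono-< a<b)))

  -- Indeed, the weights
  -- 1/(n |row v|) and 1/(M |column x|) both sum to 1 over all incidences, so
  -- the second cannot be strictly smaller than the first everywhere.
  fractional-double-counting :
    ∀ {n m} (N : Fin n → Fin m → Bool) (u : Fin m → Bool) → 0 ℕ.< n →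
    (∀ v x → N v x ≡ true → u x ≡ true) →
    (∀ v → 0 ℕ.< count (N v)) →
    (∀ x → u x ≡ true → 0 ℕ.< count (λ v → N v x)) →
    ¬ (∀ v x → N v x ≡ true → n ℕ.* count (N v) ℕ.< count u ℕ.* count (λ v → N v x))
  fractional-double-counting {suc n′} {m} N u _ N⊆u row-pos col-pos heavier =
    ℚ.<-irrefl (trans total-by-columns (sym total-by-rows)) strictly-smaller
    where
    n = suc n′
    row : Fin n → ℕ
    row v = count (N v)
    col : Fin m → ℕ
    col x = count (λ v → N v x)
    M = count u
    M-pos : 0 ℕ.< M
    M-pos with count-pos⇒witness (N zero) (row-pos zero)
    ... | x , Nx = witness⇒count-pos u x (N⊆u zero x Nx)

    A : Fin n → Fin m → ℚ
    A v x = if N v x then recip (n ℕ.* row v) else 0ℚ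
    B : Fin n → Fin m → ℚ
    B v x = if N v x then recip (M ℕ.* col x) else 0ℚ

    row-sum : ∀ v → sum (A v) ≡ recip n
    row-sum v = trans (sum-indicator (N v) _) (recip-share {n} (s≤s z≤n) (row-pos v))
    total-by-rows : sum (λ v → sum (A v)) ≡ 1ℚ
    total-by-rows = trans (sum-cong-≗ row-sum) (trans (sum-replicate n {recip n}) (recip-whole {n} (s≤s z≤n)))

    col-sum : ∀ x → sum (λ v → B v x) ≡ (if u x then recip M else 0ℚ)
    col-sum x with u x in ux
    ... | true  = trans (sum-indicator (λ v → N v x) _) (recip-share {M} M-pos (col-pos x ux))
    ... | false = trans (sum-cong-≗ vanish) (sum-replicate-zero n)
      where
      vanish : ∀ v → B v x ≡ 0ℚ
      vanish v with N v x in Nvx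
      ... | true  = contradiction (trans (sym (N⊆u v x Nvx)) ux) λ ()
      ... | false = refl
    total-by-columns : sum (λ x → sum (λ v → B v x)) ≡ 1ℚ
    total-by-columns = trans (sum-cong-≗ col-sum) (trans (sum-indicator u (recip M)) (recip-whole {M} M-pos))

    weight< : ∀ v x → N v x ≡ true → recip (M ℕ.* col x) < recip (n ℕ.* row v)
    weight< v x Nvx = recip-antitone {n ℕ.* row v} (ℕ.*-mono-< {0} {n} {0} {row v} (s≤s z≤n) (row-pos v)) (heavier v x Nvx)
    B<A : ∀ v x → N v x ≡ true → B v x < A v x
    B<A v x Nvx with N v x in Nvx′
    ... | true = weight< v x Nvx′
    B≤A : ∀ v x → B v x ≤ A v x
    B≤A v x with N v x in Nvx
    ... | true  = ℚ.<⇒≤ (weight< v x Nvx)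
    ... | false = ℚ.≤-refl

    strictly-smaller : sum (λ x → sum (λ v → B v x)) < sum (λ v → sum (A v))
    strictly-smaller with count-pos⇒witness (N zero) (row-pos zero)
    ... | x₀ , Nx₀ = subst (_< _) (∑-comm B)
      (sum-mono-< (λ v → sum-mono-≤ (B≤A v)) zero (sum-mono-< (B≤A zero) x₀ (B<A zero x₀ Nx₀)))

open Fractions using (fractional-double-counting)

open import Data.Nat using (_+_; _*_; _≤_; _<_; _≤?_; >-nonZero)
open import Data.Fin.Subset using (Subset; _∩_; _∪_; ∣_∣; ⋃; ⁅_⁆; ∁; ⊤; _∈_; _⊆_; Nonempty)
open import Data.Fin.Subset.Properties
  using (p⊆p∪q; q⊆p∪q; x∈⁅x⁆; x∈⁅y⁆⇒x≡y; x∈p∪q⁺; x∈p∪q⁻; x∈p∩q⁺; x∈p∩q⁻; x∈∁p⇒x∉p; x∉p⇒x∈∁p;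
         ⊆-antisym; ⊆⊤; ∣⁅x⁆∣≡1; ∣⊤∣≡n)
open import Data.Fin.Permutation using (Permutation′; _⟨$⟩ʳ_; _⟨$⟩ˡ_; inverseʳ)
open import Data.Vec using ([]; _∷_; lookup)
open import Data.Vec.Properties using ([]=⇒lookup; lookup⇒[]=; lookup-zipWith; tabulate∘lookup; tabulate-cong)
open import Data.List as List using (List)
open import Data.List.Membership.Propositional as ListMembership using ()
open import Data.List.Membership.Propositional.Properties using (∈-map⁺; ∈-allFin)
open import Data.List.Relation.Unary.Any using (here; there)
open import Function.Bundles using (Equivalence; _⇔_)
open import Function.Definitions using (Injective)

size≡count : ∀ {m} (p : Subset m) → ∣ p ∣ ≡ count (lookup p)
size≡count []           = refl
size≡count (true  ∷ p) = cong suc (size≡count p)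
size≡count (false ∷ p) = size≡count p

lookup-∩ : ∀ {m} (p q : Subset m) x → lookup (p ∩ q) x ≡ lookup p x ∧ lookup q x
lookup-∩ p q x = lookup-zipWith _∧_ x p q

subset-ext : ∀ {m} (p q : Subset m) → (∀ x → lookup p x ≡ lookup q x) → p ≡ q
subset-ext p q p≗q = trans (sym (tabulate∘lookup p)) (trans (tabulate-cong p≗q) (tabulate∘lookup q))

⊆-UnionOf : ∀ {n m} (S : Fin n → Subset m) v → S v ⊆ UnionOf S
⊆-UnionOf {n} S v = ⊆-⋃ (∈-map⁺ S (∈-allFin v))
  where
  ⊆-⋃ : ∀ {p} {L : List (Subset _)} → p ListMembership.∈ L → p ⊆ ⋃ L
  ⊆-⋃ {L = q List.∷ L} (here refl) = p⊆p∪q (⋃ L)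
  ⊆-⋃ {L = q List.∷ L} (there p∈L) = q⊆p∪q q (⋃ L) ∘ ⊆-⋃ p∈L

two-others : ∀ {k} (v : Fin (3 + k)) → ∃₂ λ a b → a ≢ v × b ≢ v × a ≢ b
two-others zero             = suc zero , suc (suc zero) , (λ ()) , (λ ()) , (λ ())
two-others (suc zero)       = zero , suc (suc zero) , (λ ()) , (λ ()) , (λ ())
two-others (suc (suc v))    = zero , suc zero , (λ ()) , (λ ()) , (λ ())

module FamilyOfK {k m} (S : Fin (3 + k) → Subset m) (rep : FamRep (K (3 + k)) m S) where
  open FamRep rep
  open MultiRep multiRep

  n : ℕ
  n = 3 + k

  χ : Fin n → Fin m → Bool
  χ v = lookup (S v)

  u : Fin m → Bool
  u = lookup (UnionOf S)

  in-union : ∀ v x → χ v x ≡ true → u x ≡ true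
  in-union v x χvx = []=⇒lookup (⊆-UnionOf S v (lookup⇒[]= x (S v) χvx))

  shared : Fin n → Fin n → Fin m → Bool
  shared a b x = χ a x ∧ χ b x

  one-shared : ∀ {a b} → a ≢ b → count (shared a b) ≡ 1
  one-shared {a} {b} a≢b = begin
    count (shared a b)        ≡⟨ count-cong (lookup-∩ (S a) (S b)) ⟨
    count (lookup (S a ∩ S b)) ≡⟨ size≡count (S a ∩ S b) ⟨
    ∣ S a ∩ S b ∣             ≡⟨ edge a b a≢b a≢b ⟩
    1                          ∎
    where open ≡-Reasoning

  shared-point : ∀ {a b} → a ≢ b → ∃ λ x → shared a b x ≡ true
  shared-point a≢b = count-pos⇒witness _ (subst (0 <_) (sym (one-shared a≢b)) (s≤s z≤n))

  shared-unique : ∀ {a b x y} → a ≢ b → shared a b x ≡ true → shared a b y ≡ true → x ≡ y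
  shared-unique a≢b = count-one⇒unique _ (one-shared a≢b)

  same-members : ∀ {a b} → (∀ x → χ a x ≡ χ b x) → a ≡ b
  same-members {a} {b} χa≗χb = distinct (subset-ext (S a) (S b) χa≗χb)

  -- No set contains the whole union U.  Otherwise every other set meets it in
  -- all of its points, so is a single point; two further sets (which exist as
  -- n ≥ 3) then both equal the single point they share.
  point-outside : ∀ v → ∃ λ x → u x ≡ true × χ v x ≡ false
  point-outside v with find (λ x → u x ∧ not (χ v x))
  ... | inj₁ (x , found) with ∧-true⁻ found
  ...   | ux , ¬χvx = x , ux , not-true⁻ ¬χvx
  point-outside v | inj₂ none with two-others v
  ... | a , b , a≢v , b≢v , a≢b with shared-point a≢b
  ...   | c , shared-c = contradiction (same-members χa≗χb) a≢b
    where
    covers : ∀ {w x} → χ w x ≡ true → χ v x ≡ true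
    covers {w} {x} χwx with χ v x in χvx
    ... | true  = refl
    ... | false = contradiction (trans (sym (none x)) (cong₂ _∧_ (in-union w x χwx) (cong not χvx))) λ ()
    single : ∀ {w x y} → w ≢ v → χ w x ≡ true → χ w y ≡ true → x ≡ y
    single w≢v χwx χwy = shared-unique w≢v (∧-true⁺ χwx (covers χwx)) (∧-true⁺ χwy (covers χwy))
    χac = proj₁ (∧-true⁻ shared-c)
    χbc = proj₂ (∧-true⁻ shared-c)
    χa≗χb : ∀ x → χ a x ≡ χ b x
    χa≗χb x = bool-ext (λ χax → subst (λ y → χ b y ≡ true) (single a≢v χac χax) χbc)
                       (λ χbx → subst (λ y → χ a y ≡ true) (single b≢v χbc χbx) χac)

  degree : Fin m → ℕ
  degree x = count (λ w → χ w x)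

  -- A point x outside S v lies in at most |S v| sets: each set through x
  -- meets S v, and two sets through x meet S v in different points.
  degree≤size : ∀ {v x} → χ v x ≡ false → degree x ≤ count (χ v)
  degree≤size {v} {x} χvx = count-injective (λ w → χ w x) (χ v) meet maps inj
    where
    through⇒≢v : ∀ {w} → χ w x ≡ true → w ≢ v
    through⇒≢v χwx refl = contradiction (trans (sym χwx) χvx) λ ()
    -- where S w meets S v (x when there is no such point)
    meet : Fin n → Fin m
    meet w = [ proj₁ , (λ _ → x) ] (find (shared w v))
    meet-shared : ∀ {w} → χ w x ≡ true → shared w v (meet w) ≡ true
    meet-shared {w} χwx with find (shared w v)
    ... | inj₁ (_ , shared-y) = shared-y
    ... | inj₂ none with shared-point (through⇒≢v χwx)
    ...   | y , shared-y = contradiction (trans (sym (none y)) shared-y) λ ()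
    maps : ∀ w → χ w x ≡ true → χ v (meet w) ≡ true
    maps w χwx = proj₂ (∧-true⁻ (meet-shared χwx))
    inj : ∀ {w w′} → χ w x ≡ true → χ w′ x ≡ true → meet w ≡ meet w′ → w ≡ w′
    inj {w} {w′} χwx χw′x same with w ≟ w′
    ... | yes w≡w′ = w≡w′
    ... | no  w≢w′ = contradiction (trans (sym χvx) (subst (λ y → χ v y ≡ true) (sym x≡meet) (maps w χwx))) λ ()
      where
      χw′-meet : χ w′ (meet w) ≡ true
      χw′-meet = subst (λ y → χ w′ y ≡ true) (sym same) (proj₁ (∧-true⁻ (meet-shared χw′x)))
      x≡meet : x ≡ meet w
      x≡meet = shared-unique w≢w′ (∧-true⁺ χwx χw′x) (∧-true⁺ (proj₁ (∧-true⁻ (meet-shared χwx))) χw′-meet)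

  -- If a point x₀ lies in every set, then n ≤ |U|: choosing in each set a
  -- point other than x₀ (x₀ itself if there is none) is injective, because
  -- two sets share only x₀ and at most one set is {x₀}.
  pencil-bound : ∀ {x₀} → (∀ v → χ v x₀ ≡ true) → n ≤ count u
  pencil-bound {x₀} through =
    subst (_≤ count u) (count-true n) (count-injective (λ _ → true) u pick (λ v _ → in-union v (pick v) (pick∈ v)) inj)
    where
    pick : Fin n → Fin m
    pick v = [ proj₁ , (λ _ → x₀) ] (find (χ v without x₀))
    pick∈ : ∀ v → χ v (pick v) ≡ true
    pick∈ v with find (χ v without x₀)
    ... | inj₁ (_ , found) = proj₁ (without⁻ {f = χ v} found)
    ... | inj₂ _           = through v
    only-x₀ : ∀ {v} → pick v ≡ x₀ → ∀ {y} → χ v y ≡ true → y ≡ x₀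
    only-x₀ {v} picked {y} χvy with find (χ v without x₀)
    ... | inj₁ (_ , found) = contradiction picked (proj₂ (without⁻ {f = χ v} found))
    ... | inj₂ none with y ≟ x₀
    ...   | yes y≡x₀ = y≡x₀
    ...   | no  y≢x₀ = contradiction (trans (sym (none y)) (without⁺ {f = χ v} χvy y≢x₀)) λ ()
    inj : ∀ {v w} → true ≡ true → true ≡ true → pick v ≡ pick w → v ≡ w
    inj {v} {w} _ _ same with v ≟ w | pick v ≟ x₀
    ... | yes v≡w | _ = v≡w
    ... | no  v≢w | yes picked = same-members λ y →
          bool-ext (λ χvy → subst (λ z → χ w z ≡ true) (sym (only-x₀ picked χvy)) (through w))
                   (λ χwy → subst (λ z → χ v z ≡ true) (sym (only-x₀ (trans (sym same) picked) χwy)) (through v))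
    ... | no  v≢w | no  not-picked = contradiction (sym (shared-unique v≢w (∧-true⁺ (through v) (through w)) shared-pick)) not-picked
      where
      shared-pick : shared v w (pick v) ≡ true
      shared-pick = ∧-true⁺ (pick∈ v) (subst (λ z → χ w z ≡ true) (sym same) (pick∈ w))

  size-pos : ∀ v → 0 < count (χ v)
  size-pos v with nonempty v
  ... | x , x∈Sv = witness⇒count-pos (χ v) x ([]=⇒lookup x∈Sv)

  missing : Fin n → Fin m → Bool
  missing v x = u x ∧ not (χ v x)

  row-split : ∀ v → count (χ v) + count (missing v) ≡ count u
  row-split v = trans (cong (_+ count (missing v)) (count-cong χ≡u∧χ)) (count-split u (χ v))
    where
    χ≡u∧χ : ∀ x → χ v x ≡ u x ∧ χ v x
    χ≡u∧χ x = bool-ext (λ χvx → ∧-true⁺ (in-union v x χvx) χvx) (proj₂ ∘ ∧-true⁻)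

  col-split : ∀ x → u x ≡ true → degree x + count (λ v → missing v x) ≡ n
  col-split x ux = trans (cong (degree x +_) (count-cong λ v → cong (_∧ not (χ v x)) ux))
                         (trans (count-split (λ _ → true) (λ v → χ v x)) (count-true n))

  -- If no point lies in every set, then n ≤ |U|.  Otherwise |U| < n, and
  -- since deg x ≤ |S v| for x ∉ S v, every non-incidence (v , x) inside U
  -- has n |U ∖ S v| < |U| (n − deg x), contradicting fractional double counting.
  spread-bound : (∀ x → ¬ (∀ v → χ v x ≡ true)) → n ≤ count u
  spread-bound no-pencil with n ≤? count u
  ... | yes n≤M = n≤M
  ... | no  n≰M = contradiction heavier
        (fractional-double-counting missing u (s≤s z≤n) (λ v x → proj₁ ∘ ∧-true⁻) row-pos col-pos)
    where
    M = count u
    row-pos : ∀ v → 0 < count (missing v)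
    row-pos v with point-outside v
    ... | x , ux , χvx = witness⇒count-pos (missing v) x (∧-true⁺ ux (cong not χvx))
    col-pos : ∀ x → u x ≡ true → 0 < count (λ v → missing v x)
    col-pos x ux with ¬∀⟶∃¬ n (λ v → χ v x ≡ true) (λ v → χ v x Bool.≟ true) (no-pencil x)
    ... | v , χvx≢true = witness⇒count-pos (λ w → missing w x) v (∧-true⁺ ux (cong not (¬-not χvx≢true)))
    heavier : ∀ v x → missing v x ≡ true → n * count (missing v) < M * count (λ w → missing w x)
    heavier v x missing-vx = trade balance (ℕ.≤-<-trans (ℕ.*-monoʳ-≤ M (degree≤size χvx)) M-deg<n-size)
      where
      ux = proj₁ (∧-true⁻ missing-vx)
      χvx = not-true⁻ (proj₂ (∧-true⁻ missing-vx))
      M-deg<n-size : M * count (χ v) < n * count (χ v)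
      M-deg<n-size = ℕ.*-monoˡ-< (count (χ v)) {{>-nonZero (size-pos v)}} (ℕ.≰⇒> n≰M)
      row = count (missing v)
      col = count (λ w → missing w x)
      balance : n * row + n * count (χ v) ≡ M * degree x + M * col
      balance = begin
        n * row + n * count (χ v)   ≡⟨ ℕ.*-distribˡ-+ n row _ ⟨
        n * (row + count (χ v))     ≡⟨ cong (n *_) (trans (ℕ.+-comm row _) (row-split v)) ⟩
        n * M                       ≡⟨ ℕ.*-comm n M ⟩
        M * n                       ≡⟨ cong (M *_) (col-split x ux) ⟨
        M * (degree x + col)        ≡⟨ ℕ.*-distribˡ-+ M (degree x) col ⟩
        M * degree x + M * col      ∎
        where open ≡-Reasoning
      trade : ∀ {a b c d} → a + b ≡ d + c → d < b → a < c
      trade {a} {b} {c} {d} eq d<b = ℕ.+-cancelʳ-< b a c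
        (subst (_< c + b) (sym eq) (subst (_< c + b) (ℕ.+-comm c d) (ℕ.+-monoʳ-< c d<b)))

  size-of-union : n ≤ ∣ UnionOf S ∣
  size-of-union = subst (n ≤_) (sym (size≡count (UnionOf S))) bound
    where
    bound : n ≤ count u
    bound with any? (λ x → all? (λ v → χ v x Bool.≟ true))
    ... | yes (_ , through) = pencil-bound through
    ... | no  no-pencil     = spread-bound (λ x through → no-pencil (x , through))

size-one : ∀ {m} (p : Subset m) {c} → c ∈ p → (∀ {x} → x ∈ p → x ≡ c) → ∣ p ∣ ≡ 1
size-one p {c} c∈p only-c = trans (cong ∣_∣ p≡⁅c⁆) (∣⁅x⁆∣≡1 c)
  where
  p≡⁅c⁆ : p ≡ ⁅ c ⁆
  p≡⁅c⁆ = ⊆-antisym (λ x∈p → subst (_∈ ⁅ c ⁆) (sym (only-c x∈p)) (x∈⁅x⁆ c))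
                    (λ x∈⁅c⁆ → subst (_∈ p) (sym (x∈⁅y⁆⇒x≡y c x∈⁅c⁆)) c∈p)

complete-rep : ∀ {n m} (S : Fin n → Subset m) → (∀ v → Nonempty (S v)) → Injective _≡_ _≡_ S →
               (∀ {a b} → a ≢ b → ∃ λ c → c ∈ S a × c ∈ S b × (∀ {x} → x ∈ S a → x ∈ S b → x ≡ c)) →
               FamRep (K n) m S
complete-rep S nonempty distinct meet = record
  { multiRep = record
    { nonempty = nonempty
    ; edge     = λ a b a≢b _ → one-point a≢b
    ; nonedge  = λ a b a≢b ¬adj → contradiction a≢b ¬adj
    }
  ; distinct = distinct
  }
  where
  one-point : ∀ {a b} → a ≢ b → ∣ S a ∩ S b ∣ ≡ 1
  one-point {a} {b} a≢b with meet a≢b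
  ... | c , c∈Sa , c∈Sb , only-c =
    size-one (S a ∩ S b) (x∈p∩q⁺ (c∈Sa , c∈Sb)) (λ x∈∩ → let x∈Sa , x∈Sb = x∈p∩q⁻ (S a) (S b) x∈∩ in only-c x∈Sa x∈Sb)

star : ∀ {n} → Fin (suc n) → Subset (suc n)
star v = ⁅ zero ⁆ ∪ ⁅ v ⁆

∈star⁻ : ∀ {n} {v x : Fin (suc n)} → x ∈ star v → x ≡ zero ⊎ x ≡ v
∈star⁻ {v = v} x∈ = Sum.map (x∈⁅y⁆⇒x≡y zero) (x∈⁅y⁆⇒x≡y v) (x∈p∪q⁻ ⁅ zero ⁆ ⁅ v ⁆ x∈)

∈star⁺ : ∀ {n} {v x : Fin (suc n)} → x ≡ zero ⊎ x ≡ v → x ∈ star v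
∈star⁺ (inj₁ refl) = x∈p∪q⁺ (inj₁ (x∈⁅x⁆ zero))
∈star⁺ (inj₂ refl) = x∈p∪q⁺ (inj₂ (x∈⁅x⁆ _))

star-injective : ∀ {n} → Injective _≡_ _≡_ (star {n})
star-injective {x = a} {b} eq with ∈star⁻ (subst (a ∈_) eq (∈star⁺ (inj₂ refl)))
                                  | ∈star⁻ (subst (b ∈_) (sym eq) (∈star⁺ (inj₂ refl)))
... | inj₂ a≡b   | _          = a≡b
... | inj₁ a≡0   | inj₁ b≡0   = trans a≡0 (sym b≡0)
... | inj₁ _     | inj₂ b≡a   = sym b≡a

star-meet : ∀ {n} {a b : Fin (suc n)} → a ≢ b →
            ∃ λ c → c ∈ star a × c ∈ star b × (∀ {x} → x ∈ star a → x ∈ star b → x ≡ c)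
star-meet a≢b = zero , ∈star⁺ (inj₁ refl) , ∈star⁺ (inj₁ refl) , centre
  where
  centre : ∀ {x} → x ∈ star _ → x ∈ star _ → x ≡ zero
  centre x∈a x∈b with ∈star⁻ x∈a | ∈star⁻ x∈b
  ... | inj₁ x≡0 | _        = x≡0
  ... | inj₂ _   | inj₁ x≡0 = x≡0
  ... | inj₂ x≡a | inj₂ x≡b = contradiction (trans (sym x≡a) x≡b) a≢b

star-rep : ∀ {n} → FamRep (K (suc n)) (suc n) star
star-rep = complete-rep star (λ v → zero , ∈star⁺ (inj₁ refl)) star-injective star-meet

star-union : ∀ {n} → ∣ UnionOf (star {n}) ∣ ≡ suc n
star-union {n} = trans (cong ∣_∣ (⊆-antisym {i = UnionOf (star {n})} ⊆⊤ (λ {x} _ → ⊆-UnionOf star x (∈star⁺ (inj₂ refl))))) (∣⊤∣≡n (suc n))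

flipped : ∀ {n} → Fin (2 + n) → Subset (2 + n)
flipped zero    = ∁ ⁅ zero ⁆
flipped (suc v) = star (suc v)

∈∁⁅0⁆⁺ : ∀ {n} {x : Fin (suc n)} → x ≢ zero → x ∈ ∁ ⁅ zero ⁆
∈∁⁅0⁆⁺ x≢0 = x∉p⇒x∈∁p (x≢0 ∘ x∈⁅y⁆⇒x≡y zero)

∈∁⁅0⁆⁻ : ∀ {n} {x : Fin (suc n)} → x ∈ ∁ ⁅ zero ⁆ → x ≢ zero
∈∁⁅0⁆⁻ x∈ refl = x∈∁p⇒x∉p x∈ (x∈⁅x⁆ zero)

flipped-injective : ∀ {n} → Injective _≡_ _≡_ (flipped {n})
flipped-injective {x = zero}  {zero}  _  = refl
flipped-injective {x = zero}  {suc b} eq = contradiction refl (∈∁⁅0⁆⁻ (subst (zero ∈_) (sym eq) (∈star⁺ {v = suc b} (inj₁ refl))))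
flipped-injective {x = suc a} {zero}  eq = contradiction refl (∈∁⁅0⁆⁻ (subst (zero ∈_) eq (∈star⁺ {v = suc a} (inj₁ refl))))
flipped-injective {x = suc a} {suc b} eq = star-injective eq

co-centre-meet : ∀ {n} (v : Fin (suc n)) →
                 ∃ λ c → c ∈ ∁ ⁅ zero ⁆ × c ∈ star (suc v) × (∀ {x} → x ∈ ∁ ⁅ zero ⁆ → x ∈ star (suc v) → x ≡ c)
co-centre-meet v = suc v , ∈∁⁅0⁆⁺ (λ ()) , ∈star⁺ (inj₂ refl) , only-v
  where
  only-v : ∀ {x} → x ∈ ∁ ⁅ zero ⁆ → x ∈ star (suc v) → x ≡ suc v
  only-v x∈∁ x∈star with ∈star⁻ {v = suc v} x∈star
  ... | inj₁ x≡0 = contradiction x≡0 (∈∁⁅0⁆⁻ x∈∁)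
  ... | inj₂ x≡v = x≡v

flipped-meet : ∀ {n} {a b : Fin (2 + n)} → a ≢ b →
               ∃ λ c → c ∈ flipped a × c ∈ flipped b × (∀ {x} → x ∈ flipped a → x ∈ flipped b → x ≡ c)
flipped-meet {a = zero}  {zero}  a≢b = contradiction refl a≢b
flipped-meet {a = zero}  {suc b} _   = co-centre-meet b
flipped-meet {a = suc a} {zero}  _   with co-centre-meet a
... | c , c∈∁ , c∈star , only-c = c , c∈star , c∈∁ , flip only-c
flipped-meet {a = suc a} {suc b} a≢b = star-meet a≢b

flipped-rep : ∀ {n} → FamRep (K (2 + n)) (2 + n) flipped
flipped-rep = complete-rep flipped nonempty flipped-injective flipped-meet
  where
  nonempty : ∀ v → Nonempty (flipped v)
  nonempty zero    = suc zero , ∈∁⁅0⁆⁺ (λ ())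
  nonempty (suc v) = zero , ∈star⁺ {v = suc v} (inj₁ refl)

-- No permutation π of the ground set carries star to flipped: π⁻¹ would map
-- the two points 1, 2 of flipped 0 into star 0 = {0}.
star≁flipped : ∀ {k} (π : Permutation′ (3 + k)) →
               ¬ (∀ v x → (x ∈ star v) ⇔ ((π ⟨$⟩ʳ x) ∈ flipped v))
star≁flipped π carries = contradiction one≡two λ ()
  where
  centre-preimage : ∀ t → t ≢ zero → π ⟨$⟩ˡ t ≡ zero
  centre-preimage t t≢0 with ∈star⁻ (Equivalence.from (carries zero (π ⟨$⟩ˡ t))
                                  (subst (_∈ flipped zero) (sym (inverseʳ π)) (∈∁⁅0⁆⁺ t≢0)))
  ... | inj₁ at-0 = at-0
  ... | inj₂ at-0 = at-0
  one≡two : suc zero ≡ suc (suc zero)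
  one≡two = begin
    suc zero                         ≡⟨ inverseʳ π ⟨
    π ⟨$⟩ʳ (π ⟨$⟩ˡ suc zero)         ≡⟨ cong (π ⟨$⟩ʳ_) (trans (centre-preimage _ λ ()) (sym (centre-preimage _ λ ()))) ⟩
    π ⟨$⟩ʳ (π ⟨$⟩ˡ suc (suc zero))   ≡⟨ inverseʳ π ⟩
    suc (suc zero)                   ∎
    where open ≡-Reasoning

theorem3p1 : (n : ℕ) → n ≥ 3 → IsOmegaF (K n) n × ¬ UIF (K n)
theorem3p1 (suc (suc (suc k))) (s≤s (s≤s (s≤s _))) = ω-is-n , not-uif
  where
  n = 3 + k
  ω-is-n : IsOmegaF (K n) n
  ω-is-n = (n , star , star-rep , star-union) , λ m S rep → FamilyOfK.size-of-union S rep
  not-uif : ¬ UIF (K n)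
  not-uif uif with uif n ω-is-n star flipped star-rep flipped-rep
  ... | π , carries = star≁flipped π carries
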